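{- Let $n$ be a positive integer. Then $$K_nK_{n-1}\cdots K_2K_1=\mathbf{e}_1\mathbf{r}_1-\sum_{j=1}^{n-1}\mathbf{e}_{j+1}\mathbf{e}_j^T.$$ That is, its first row is $\mathbf{r}_1=(-1,1,-1,\dots,(-1)^n)$, and for $2\le i\le n$ its $i$-th row has $-1$ in column $i-1$ and zeros elsewhere. Also $$K_1K_2\cdots K_n=-\sum_{j=1}^{n-1}\mathbf{e}_j\mathbf{e}_{j+1}^T+\mathbf{e}_n\mathbf{r}_n.$$ That is, for $1\le i\le n-1$ its $i$-th row has $-1$ in column $i+1$ and zeros elsewhere, and its last row is $\mathbf{r}_n=((-1)^n,(-1)^{n+1},\dots,(-1)^{2n-1})$. Moreover, $$(K_nK_{n-1}\cdots K_1)^{n+1}=(K_1K_2\cdots K_n)^{n+1}=\mathrm{Id},$$ and $n+1$ is the smallest $N\ge1$ with $(K_nK_{n-1}\cdots K_1)^N=(K_1K_2\cdots K_n)^N=\mathrm{Id}$.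
   Context: For a positive integer $n$: - $\mathbf{e}_j$ is the $j$-th standard basis column vector of $\mathbb{Z}^n$; - $\mathbf{r}_j=\big((-1)^j,(-1)^{j+1},\dots,(-1)^{j+n-1}\big)$ is a row vector; - $K_j=\mathrm{Id}-\mathbf{e}_j\mathbf{e}_j^T+\mathbf{e}_j\mathbf{r}_j$ is the $n\times n$ identity matrix with row $j$ replaced by $\mathbf{r}_j$. -}

module Defs where

open import Data.Nat using (ℕ; zero; suc)
import Data.Nat as ℕ
open import Data.Integer using (ℤ; 0ℤ; 1ℤ; -1ℤ; _+_; _*_; -_)
open import Data.Fin using (Fin; toℕ; inject₁) renaming (suc to fsuc)
open import Data.List using (List; foldr; allFin; reverse)
open import Relation.Binary.PropositionalEquality using (_≡_)
open import Relation.Nullary.Decidable using (⌊_⌋)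
open import Data.Fin.Properties using (_≟_)
open import Data.Bool using (if_then_else_)

-- n × n integer matrices; entry (i , k) = row i, column k (0-based Fin indices,
-- so Fin index j corresponds to the paper's index j+1).
Mat : ℕ → Set
Mat n = Fin n → Fin n → ℤ

Vecℤ : ℕ → Set
Vecℤ n = Fin n → ℤ

_≋_ : ∀ {n} → Mat n → Mat n → Set
A ≋ B = ∀ i k → A i k ≡ B i k
infix 4 _≋_

Σ : ∀ {n} → (Fin n → ℤ) → ℤ
Σ {n} f = foldr (λ i acc → f i + acc) 0ℤ (allFin n)

Id : ∀ {n} → Mat n
Id i k = if ⌊ i ≟ k ⌋ then 1ℤ else 0ℤ

_⊕_ : ∀ {n} → Mat n → Mat n → Mat n
(A ⊕ B) i k = A i k + B i k

⊝_ : ∀ {n} → Mat n → Mat n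
(⊝ A) i k = - A i k

_⊗_ : ∀ {n} → Mat n → Mat n → Mat n
(A ⊗ B) i k = Σ (λ l → A i l * B l k)

infixl 7 _⊗_
infixl 6 _⊕_

ΣM : ∀ {n} m → (Fin m → Mat n) → Mat n
ΣM m F i k = Σ (λ j → F j i k)

_^_ : ∀ {n} → Mat n → ℕ → Mat n
A ^ zero = Id
A ^ suc p = A ⊗ (A ^ p)

e : ∀ {n} → Fin n → Vecℤ n
e j i = if ⌊ i ≟ j ⌋ then 1ℤ else 0ℤ

outer : ∀ {n} → Vecℤ n → Vecℤ n → Mat n
outer u v i k = u i * v k

sgn : ℕ → ℤ
sgn zero = 1ℤ
sgn (suc m) = - sgn m

-- r_j = ((-1)^j, (-1)^(j+1), ..., (-1)^(j+n-1)) with paper index j;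
-- for 0-based Fin index j (paper index j+1), entry at 0-based column k is
-- (-1)^((j+1)+k).
r : ∀ {n} → Fin n → Vecℤ n
r j k = sgn (suc (toℕ j ℕ.+ toℕ k))

K : ∀ {n} → Fin n → Mat n
K j = Id ⊕ (⊝ outer (e j) (e j)) ⊕ outer (e j) (r j)

prodL : ∀ {n} → List (Mat n) → Mat n
prodL = foldr _⊗_ Id

prodAsc : ∀ n → Mat n
prodAsc n = prodL (Data.List.map K (allFin n))

prodDesc : ∀ n → Mat n
prodDesc n = prodL (reverse (Data.List.map K (allFin n)))

-- Left multiplication by K j replaces row j by r j times the matrix and keeps the other rows.
-- When the descending product D is built as K (n-1) ⊗ ⋯ ⊗ (K 0 ⊗ Id), the factor K (j+1) meets
-- K j ⊗ M with rows j, j+1, … of M still identity rows; since r (j+1) · K j = - e j, the new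
-- row j+1 is minus row j of M, i.e. - e j, while row 0 is r 0.
-- Every K j is an involution, so the ascending product is the inverse of the descending one;
-- hence it equals the claimed matrix as soon as that matrix is a right inverse of the latter.
-- For the powers, let ê 0, …, ê (n-1) be the unit rows and ê n = -(1, …, 1). Up to the signs
-- (-1)^(i+k), row i of D ^ p is ê (i - p mod n+1); the step p ↦ p+1 uses that the n+1 rows ê c
-- sum to zero. So D ^ (n+1) = Id, while for 0 < p ≤ n the (0,0) entry of D ^ p is 0 or -1.

module Submission where

open import Defs
open import Data.Nat using (ℕ; suc; _≤_; _<_)
open import Data.Fin using (Fin; inject₁; fromℕ) renaming (suc to fsuc; zero to fzero)
open import Data.Product using (_×_)
open import Relation.Nullary using (¬_)

open import Algebra.Bundles using (AbelianGroup)
import Algebra.Properties.Group as GroupProperties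
open import Data.Fin using (toℕ)
open import Data.Fin.Properties using (_≟_)
import Data.Fin.Properties as FinP
open import Data.Integer using (ℤ; 0ℤ; 1ℤ; -1ℤ; _+_; _*_; -_; _-_)
import Data.Integer.Properties as ℤP
open import Data.Integer.Tactic.RingSolver using (solve-∀)
open import Data.List using (List; []; _∷_; _∷ʳ_; foldr; foldl; map; reverse; tabulate; allFin)
import Data.List.Properties as ListP
open import Data.Nat as ℕ using (zero; z≤n; s≤s; _∸_)
import Data.Nat.Properties as ℕP
open import Data.Product using (_,_)
open import Function using (id; _∘_)
open import Level using (0ℓ)
open import Relation.Binary.Bundles using (Setoid)
open import Relation.Binary.PropositionalEquality
import Relation.Binary.Reasoning.Setoid as SetoidReasoning
open import Relation.Nullary using (yes; no; contradiction)
open import Algebra.Properties.Semiring.Sum ℤP.+-*-semiring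
  using (sum; sum-cong-≗; sum-replicate-zero; sum-init-last; ∑-distrib-+; ∑-comm; *-distribˡ-sum; *-distribʳ-sum)

Σ≡sum : ∀ {n} (f : Fin n → ℤ) → Σ f ≡ sum f
Σ≡sum {zero}  f = refl
Σ≡sum {suc n} f = cong (f fzero +_) (begin
  foldr (λ i acc → f i + acc) 0ℤ (tabulate fsuc)         ≡⟨ cong (foldr (λ i acc → f i + acc) 0ℤ) (ListP.map-tabulate id fsuc) ⟨
  foldr (λ i acc → f i + acc) 0ℤ (map fsuc (allFin n))   ≡⟨ ListP.foldr-map (λ i acc → f i + acc) fsuc 0ℤ (allFin n) ⟩
  Σ (f ∘ fsuc)                                           ≡⟨ Σ≡sum (f ∘ fsuc) ⟩
  sum (f ∘ fsuc)                                         ∎)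
  where open ≡-Reasoning

module _ {n : ℕ} where

  Σ-cong : {f g : Fin n → ℤ} → (∀ l → f l ≡ g l) → Σ f ≡ Σ g
  Σ-cong {f} {g} f≗g = trans (Σ≡sum f) (trans (sum-cong-≗ f≗g) (sym (Σ≡sum g)))

  Σ-zero : Σ {n} (λ _ → 0ℤ) ≡ 0ℤ
  Σ-zero = trans (Σ≡sum {n} (λ _ → 0ℤ)) (sum-replicate-zero n)

  Σ-+ : (f g : Fin n → ℤ) → Σ (λ l → f l + g l) ≡ Σ f + Σ g
  Σ-+ f g = trans (Σ≡sum (λ l → f l + g l)) (trans (∑-distrib-+ f g) (sym (cong₂ _+_ (Σ≡sum f) (Σ≡sum g))))

  Σ-*ˡ : (c : ℤ) (f : Fin n → ℤ) → Σ (λ l → c * f l) ≡ c * Σ f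
  Σ-*ˡ c f = trans (Σ≡sum (λ l → c * f l)) (sym (trans (cong (c *_) (Σ≡sum f)) (*-distribˡ-sum c f)))

  Σ-*ʳ : (c : ℤ) (f : Fin n → ℤ) → Σ (λ l → f l * c) ≡ Σ f * c
  Σ-*ʳ c f = trans (Σ≡sum (λ l → f l * c)) (sym (trans (cong (_* c) (Σ≡sum f)) (*-distribʳ-sum c f)))

  Σ-neg : (f : Fin n → ℤ) → Σ (λ l → - f l) ≡ - Σ f
  Σ-neg f = begin
    Σ (λ l → - f l)      ≡⟨ Σ-cong (λ l → ℤP.-1*i≡-i (f l)) ⟨
    Σ (λ l → -1ℤ * f l)  ≡⟨ Σ-*ˡ -1ℤ f ⟩
    -1ℤ * Σ f            ≡⟨ ℤP.-1*i≡-i (Σ f) ⟩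
    - Σ f                ∎
    where open ≡-Reasoning

  Σ-comm : (f : Fin n → Fin n → ℤ) → Σ (λ l → Σ (f l)) ≡ Σ (λ l′ → Σ (λ l → f l l′))
  Σ-comm f = begin
    Σ (λ l → Σ (f l))                    ≡⟨ Σ≡sum (λ l → Σ (f l)) ⟩
    sum (λ l → Σ (f l))                  ≡⟨ sum-cong-≗ (λ l → Σ≡sum (f l)) ⟩
    sum (λ l → sum (f l))                ≡⟨ ∑-comm f ⟩
    sum (λ l′ → sum (λ l → f l l′))      ≡⟨ sum-cong-≗ (λ l′ → Σ≡sum (λ l → f l l′)) ⟨
    sum (λ l′ → Σ (λ l → f l l′))        ≡⟨ Σ≡sum (λ l′ → Σ (λ l → f l l′)) ⟨
    Σ (λ l′ → Σ (λ l → f l l′))          ∎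
    where open ≡-Reasoning

Σ-suc : ∀ {n} (f : Fin (suc n) → ℤ) → Σ f ≡ f fzero + Σ (f ∘ fsuc)
Σ-suc f = trans (Σ≡sum f) (cong (f fzero +_) (sym (Σ≡sum (f ∘ fsuc))))

Σ-init-last : ∀ {n} (f : Fin (suc n) → ℤ) → Σ f ≡ Σ (f ∘ inject₁) + f (fromℕ n)
Σ-init-last f = trans (Σ≡sum f) (trans (sum-init-last f) (cong (_+ f (fromℕ _)) (sym (Σ≡sum (f ∘ inject₁)))))

Id-diag : ∀ {n} (i : Fin n) → Id i i ≡ 1ℤ
Id-diag i with i ≟ i
... | yes _   = refl
... | no i≢i = contradiction refl i≢i

Id-off : ∀ {n} {i k : Fin n} → i ≢ k → Id i k ≡ 0ℤ
Id-off {i = i} {k} i≢k with i ≟ k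
... | yes i≡k = contradiction i≡k i≢k
... | no _    = refl

Id-sym : ∀ {n} (i k : Fin n) → Id i k ≡ Id k i
Id-sym i k with i ≟ k
... | yes refl = sym (Id-diag i)
... | no i≢k   = sym (Id-off (i≢k ∘ sym))

Id-suc : ∀ {n} (i k : Fin n) → Id (fsuc i) (fsuc k) ≡ Id i k
Id-suc i k with i ≟ k
... | yes _ = refl
... | no _  = refl

Id-inject₁ : ∀ {n} (i k : Fin n) → Id (inject₁ i) (inject₁ k) ≡ Id i k
Id-inject₁ i k with i ≟ k
... | yes refl = Id-diag (inject₁ i)
... | no i≢k   = Id-off (i≢k ∘ FinP.inject₁-injective)

Σ-*Id : ∀ {n} (f : Fin n → ℤ) (k : Fin n) → Σ (λ l → f l * Id l k) ≡ f k
Σ-*Id f fzero = begin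
  Σ (λ l → f l * Id l fzero)
    ≡⟨ Σ-suc (λ l → f l * Id l fzero) ⟩
  f fzero * 1ℤ + Σ (λ l → f (fsuc l) * 0ℤ)
    ≡⟨ cong₂ _+_ (ℤP.*-identityʳ (f fzero)) (trans (Σ-*ʳ 0ℤ (f ∘ fsuc)) (ℤP.*-zeroʳ (Σ (f ∘ fsuc)))) ⟩
  f fzero + 0ℤ
    ≡⟨ ℤP.+-identityʳ (f fzero) ⟩
  f fzero
    ∎
  where open ≡-Reasoning
Σ-*Id f (fsuc k) = begin
  Σ (λ l → f l * Id l (fsuc k))
    ≡⟨ Σ-suc (λ l → f l * Id l (fsuc k)) ⟩
  f fzero * 0ℤ + Σ (λ l → f (fsuc l) * Id (fsuc l) (fsuc k))
    ≡⟨ cong₂ _+_ (ℤP.*-zeroʳ (f fzero)) (Σ-cong (λ l → cong (f (fsuc l) *_) (Id-suc l k))) ⟩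
  0ℤ + Σ (λ l → f (fsuc l) * Id l k)
    ≡⟨ ℤP.+-identityˡ _ ⟩
  Σ (λ l → f (fsuc l) * Id l k)
    ≡⟨ Σ-*Id (f ∘ fsuc) k ⟩
  f (fsuc k)
    ∎
  where open ≡-Reasoning

Σ-Id* : ∀ {n} (k : Fin n) (f : Fin n → ℤ) → Σ (λ l → Id k l * f l) ≡ f k
Σ-Id* k f = trans (Σ-cong (λ l → trans (cong (_* f l) (Id-sym k l)) (ℤP.*-comm (Id l k) (f l)))) (Σ-*Id f k)

Σ-Id : ∀ {n} (k : Fin n) → Σ (λ l → Id l k) ≡ 1ℤ
Σ-Id k = trans (Σ-cong (λ l → sym (ℤP.*-identityˡ (Id l k)))) (Σ-*Id (λ _ → 1ℤ) k)

infixl 7 _·_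

_·_ : ∀ {n} → Vecℤ n → Mat n → Vecℤ n
(v · A) k = Σ (λ l → v l * A l k)

module _ {n : ℕ} where

  ·-congˡ : {v w : Vecℤ n} (A : Mat n) → v ≗ w → v · A ≗ w · A
  ·-congˡ A v≗w k = Σ-cong (λ l → cong (_* A l k) (v≗w l))

  ·-congʳ : (v : Vecℤ n) {A B : Mat n} → A ≋ B → v · A ≗ v · B
  ·-congʳ v A≋B k = Σ-cong (λ l → cong (v l *_) (A≋B l k))

  ·-Id : (v : Vecℤ n) → v · Id ≗ v
  ·-Id = Σ-*Id

  Id-· : (j : Fin n) (A : Mat n) → Id j · A ≗ A j
  Id-· j A k = Σ-Id* j (λ l → A l k)

  neg-· : (v : Vecℤ n) (A : Mat n) → (λ l → - v l) · A ≗ (λ k → - (v · A) k)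
  neg-· v A k = trans (Σ-cong (λ l → sym (ℤP.neg-distribˡ-* (v l) (A l k)))) (Σ-neg (λ l → v l * A l k))

  ·-assoc : (v : Vecℤ n) (A B : Mat n) → v · (A ⊗ B) ≗ (v · A) · B
  ·-assoc v A B k = begin
    Σ (λ l → v l * Σ (λ l′ → A l l′ * B l′ k))
      ≡⟨ Σ-cong (λ l → Σ-*ˡ (v l) (λ l′ → A l l′ * B l′ k)) ⟨
    Σ (λ l → Σ (λ l′ → v l * (A l l′ * B l′ k)))
      ≡⟨ Σ-comm (λ l l′ → v l * (A l l′ * B l′ k)) ⟩
    Σ (λ l′ → Σ (λ l → v l * (A l l′ * B l′ k)))
      ≡⟨ Σ-cong (λ l′ → Σ-cong (λ l → ℤP.*-assoc (v l) (A l l′) (B l′ k))) ⟨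
    Σ (λ l′ → Σ (λ l → v l * A l l′ * B l′ k))
      ≡⟨ Σ-cong (λ l′ → Σ-*ʳ (B l′ k) (λ l → v l * A l l′)) ⟩
    Σ (λ l′ → Σ (λ l → v l * A l l′) * B l′ k)
      ∎
    where open ≡-Reasoning

≋-setoid : ℕ → Setoid 0ℓ 0ℓ
≋-setoid n = record
  { Carrier       = Mat n
  ; _≈_           = _≋_
  ; isEquivalence = record
    { refl  = λ i k → refl
    ; sym   = λ A≋B i k → sym (A≋B i k)
    ; trans = λ A≋B B≋C i k → trans (A≋B i k) (B≋C i k)
    }
  }

module ≋-Reasoning {n : ℕ} = SetoidReasoning (≋-setoid n)
module ℤ+ = GroupProperties (AbelianGroup.group ℤP.+-0-abelianGroup)

module _ {n : ℕ} where

  open Setoid (≋-setoid n) public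
    using () renaming (refl to ≋-refl; sym to ≋-sym; trans to ≋-trans)

  ⊗-congˡ : (A : Mat n) {B B′ : Mat n} → B ≋ B′ → A ⊗ B ≋ A ⊗ B′
  ⊗-congˡ A B≋B′ i = ·-congʳ (A i) B≋B′

  ⊗-congʳ : (B : Mat n) {A A′ : Mat n} → A ≋ A′ → A ⊗ B ≋ A′ ⊗ B
  ⊗-congʳ B A≋A′ i = ·-congˡ B (A≋A′ i)

  ⊗-identityˡ : (A : Mat n) → Id ⊗ A ≋ A
  ⊗-identityˡ A i = Id-· i A

  ⊗-identityʳ : (A : Mat n) → A ⊗ Id ≋ A
  ⊗-identityʳ A i = ·-Id (A i)

  ⊗-assoc : (A B C : Mat n) → (A ⊗ B) ⊗ C ≋ A ⊗ (B ⊗ C)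
  ⊗-assoc A B C i k = sym (·-assoc (A i) B C k)

  ⊗-cong : {A A′ B B′ : Mat n} → A ≋ A′ → B ≋ B′ → A ⊗ B ≋ A′ ⊗ B′
  ⊗-cong {A} {B′ = B′} A≋A′ B≋B′ = ≋-trans (⊗-congˡ A B≋B′) (⊗-congʳ B′ A≋A′)

module _ {n : ℕ} where
  open ≋-Reasoning

  ^-cong : {A B : Mat n} → A ≋ B → ∀ p → A ^ p ≋ B ^ p
  ^-cong A≋B zero    = ≋-refl
  ^-cong A≋B (suc p) = ⊗-cong A≋B (^-cong A≋B p)

  ^-sucʳ : (A : Mat n) → ∀ p → A ^ suc p ≋ A ^ p ⊗ A
  ^-sucʳ A zero    = ≋-trans (⊗-identityʳ A) (≋-sym (⊗-identityˡ A))
  ^-sucʳ A (suc p) = begin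
    A ⊗ A ^ suc p    ≈⟨ ⊗-congˡ A (^-sucʳ A p) ⟩
    A ⊗ (A ^ p ⊗ A)  ≈⟨ ⊗-assoc A (A ^ p) A ⟨
    A ⊗ A ^ p ⊗ A    ∎

  ^-inverse : {A B : Mat n} → A ⊗ B ≋ Id → ∀ p → A ^ p ⊗ B ^ p ≋ Id
  ^-inverse AB≋Id zero = ⊗-identityˡ Id
  ^-inverse {A} {B} AB≋Id (suc p) = begin
    A ^ suc p ⊗ (B ⊗ B ^ p)    ≈⟨ ⊗-congʳ (B ⊗ B ^ p) (^-sucʳ A p) ⟩
    A ^ p ⊗ A ⊗ (B ⊗ B ^ p)    ≈⟨ ⊗-assoc (A ^ p) A (B ⊗ B ^ p) ⟩
    A ^ p ⊗ (A ⊗ (B ⊗ B ^ p))  ≈⟨ ⊗-congˡ (A ^ p) (⊗-assoc A B (B ^ p)) ⟨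
    A ^ p ⊗ (A ⊗ B ⊗ B ^ p)    ≈⟨ ⊗-congˡ (A ^ p) (⊗-congʳ (B ^ p) AB≋Id) ⟩
    A ^ p ⊗ (Id ⊗ B ^ p)       ≈⟨ ⊗-congˡ (A ^ p) (⊗-identityˡ (B ^ p)) ⟩
    A ^ p ⊗ B ^ p              ≈⟨ ^-inverse AB≋Id p ⟩
    Id                         ∎

  inverseˡ≋inverseʳ : {A B C : Mat n} → A ⊗ B ≋ Id → B ⊗ C ≋ Id → A ≋ C
  inverseˡ≋inverseʳ {A} {B} {C} AB≋Id BC≋Id = begin
    A            ≈⟨ ⊗-identityʳ A ⟨
    A ⊗ Id       ≈⟨ ⊗-congˡ A BC≋Id ⟨
    A ⊗ (B ⊗ C)  ≈⟨ ⊗-assoc A B C ⟨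
    A ⊗ B ⊗ C    ≈⟨ ⊗-congʳ C AB≋Id ⟩
    Id ⊗ C       ≈⟨ ⊗-identityˡ C ⟩
    C            ∎

  inverse-^≋Id : {A B : Mat n} → A ⊗ B ≋ Id → ∀ p → B ^ p ≋ Id → A ^ p ≋ Id
  inverse-^≋Id {B = B} AB≋Id p Bᵖ≋Id =
    inverseˡ≋inverseʳ (^-inverse AB≋Id p) (≋-trans (⊗-identityʳ (B ^ p)) Bᵖ≋Id)

  foldr-⊗ : (B : Mat n) (xs : List (Mat n)) → foldr _⊗_ B xs ≋ prodL xs ⊗ B
  foldr-⊗ B []       = ≋-sym (⊗-identityˡ B)
  foldr-⊗ B (x ∷ xs) = begin
    x ⊗ foldr _⊗_ B xs  ≈⟨ ⊗-congˡ x (foldr-⊗ B xs) ⟩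
    x ⊗ (prodL xs ⊗ B)  ≈⟨ ⊗-assoc x (prodL xs) B ⟨
    x ⊗ prodL xs ⊗ B    ∎

  prodL-∷ʳ : (xs : List (Mat n)) (x : Mat n) → prodL (xs ∷ʳ x) ≋ prodL xs ⊗ x
  prodL-∷ʳ xs x = begin
    prodL (xs ∷ʳ x)        ≡⟨ ListP.foldr-∷ʳ _⊗_ Id x xs ⟩
    foldr _⊗_ (x ⊗ Id) xs  ≈⟨ foldr-⊗ (x ⊗ Id) xs ⟩
    prodL xs ⊗ (x ⊗ Id)    ≈⟨ ⊗-congˡ (prodL xs) (⊗-identityʳ x) ⟩
    prodL xs ⊗ x           ∎

  prodL-reverse-inverse : {A : Set} (f : A → Mat n) → (∀ a → f a ⊗ f a ≋ Id) →
                          ∀ as → prodL (map f as) ⊗ prodL (reverse (map f as)) ≋ Id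
  prodL-reverse-inverse f f-inv []       = ⊗-identityˡ Id
  prodL-reverse-inverse f f-inv (a ∷ as) = begin
    f a ⊗ P ⊗ prodL (reverse (f a ∷ map f as))   ≡⟨ cong (λ xs → f a ⊗ P ⊗ prodL xs) (ListP.unfold-reverse (f a) (map f as)) ⟩
    f a ⊗ P ⊗ prodL (reverse (map f as) ∷ʳ f a)  ≈⟨ ⊗-congˡ (f a ⊗ P) (prodL-∷ʳ (reverse (map f as)) (f a)) ⟩
    f a ⊗ P ⊗ (P′ ⊗ f a)                         ≈⟨ ⊗-assoc (f a) P (P′ ⊗ f a) ⟩
    f a ⊗ (P ⊗ (P′ ⊗ f a))                       ≈⟨ ⊗-congˡ (f a) (⊗-assoc P P′ (f a)) ⟨
    f a ⊗ (P ⊗ P′ ⊗ f a)                         ≈⟨ ⊗-congˡ (f a) (⊗-congʳ (f a) (prodL-reverse-inverse f f-inv as)) ⟩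
    f a ⊗ (Id ⊗ f a)                             ≈⟨ ⊗-congˡ (f a) (⊗-identityˡ (f a)) ⟩
    f a ⊗ f a                                    ≈⟨ f-inv a ⟩
    Id                                           ∎
    where
    P P′ : Mat n
    P  = prodL (map f as)
    P′ = prodL (reverse (map f as))

≋-byRow : ∀ {n} {A B : Mat n} (j : Fin n) → (∀ i → i ≢ j → A i ≗ B i) → A j ≗ B j → A ≋ B
≋-byRow j off-j at-j i with i ≟ j
... | yes refl = at-j
... | no i≢j   = off-j i i≢j

sgn-+ : ∀ a b → sgn (a ℕ.+ b) ≡ sgn a * sgn b
sgn-+ zero    b = sym (ℤP.*-identityˡ (sgn b))
sgn-+ (suc a) b = trans (cong -_ (sgn-+ a b)) (ℤP.neg-distribˡ-* (sgn a) (sgn b))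

sgn-square : ∀ a → sgn a * sgn a ≡ 1ℤ
sgn-square zero    = refl
sgn-square (suc a) = trans (neg*neg (sgn a)) (sgn-square a)
  where
  neg*neg : ∀ x → - x * - x ≡ x * x
  neg*neg = solve-∀

sgn-double : ∀ a → sgn (a ℕ.+ a) ≡ 1ℤ
sgn-double a = trans (sgn-+ a a) (sgn-square a)

sgn-suc-cancel : ∀ a b → sgn (suc a) * sgn (a ℕ.+ b) ≡ - sgn b
sgn-suc-cancel a b = begin
  - sgn a * sgn (a ℕ.+ b)       ≡⟨ cong (- sgn a *_) (sgn-+ a b) ⟩
  - sgn a * (sgn a * sgn b)     ≡⟨ regroup (sgn a) (sgn b) ⟩
  - (sgn a * sgn a * sgn b)     ≡⟨ cong (λ x → - (x * sgn b)) (sgn-square a) ⟩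
  - (1ℤ * sgn b)                ≡⟨ cong -_ (ℤP.*-identityˡ (sgn b)) ⟩
  - sgn b                       ∎
  where
  open ≡-Reasoning
  regroup : ∀ x y → - x * (x * y) ≡ - (x * x * y)
  regroup = solve-∀

module _ {n : ℕ} where

  ·-K : (v : Vecℤ n) (j : Fin n) → v · K j ≗ (λ k → v k + v j * (r j k - e j k))
  ·-K v j k = begin
    Σ (λ l → v l * (Id l k + - (e j l * e j k) + e j l * r j k))
      ≡⟨ Σ-cong (λ l → expand (v l) (Id l k) (e j l) (e j k) (r j k)) ⟩
    Σ (λ l → v l * Id l k + v l * e j l * (r j k - e j k))
      ≡⟨ Σ-+ (λ l → v l * Id l k) (λ l → v l * e j l * (r j k - e j k)) ⟩
    Σ (λ l → v l * Id l k) + Σ (λ l → v l * e j l * (r j k - e j k))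
      ≡⟨ cong₂ _+_ (Σ-*Id v k) (Σ-*ʳ (r j k - e j k) (λ l → v l * Id l j)) ⟩
    v k + Σ (λ l → v l * Id l j) * (r j k - e j k)
      ≡⟨ cong (λ x → v k + x * (r j k - e j k)) (Σ-*Id v j) ⟩
    v k + v j * (r j k - e j k)
      ∎
    where
    open ≡-Reasoning
    expand : ∀ a b c d x → a * (b + - (c * d) + c * x) ≡ a * b + a * c * (x + - d)
    expand = solve-∀

  K-row-other : {i j : Fin n} → i ≢ j → K j i ≗ Id i
  K-row-other {i} {j} i≢j k =
    trans (cong (λ x → Id i k + - (x * e j k) + x * r j k) (Id-off i≢j))
          (trans (ℤP.+-identityʳ _) (ℤP.+-identityʳ (Id i k)))

  K-row-self : (j : Fin n) → K j j ≗ r j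
  K-row-self j k =
    trans (cong₂ (λ x y → Id j k + - (x * y) + x * r j k) (Id-diag j) (Id-sym k j))
          (cancel (Id j k) (r j k))
    where
    cancel : ∀ a c → a + - (1ℤ * a) + 1ℤ * c ≡ c
    cancel = solve-∀

  K⊗-other : {i j : Fin n} (M : Mat n) → i ≢ j → (K j ⊗ M) i ≗ M i
  K⊗-other {i} M i≢j k = trans (·-congˡ M (K-row-other i≢j) k) (Id-· i M k)

  K⊗-self : (j : Fin n) (M : Mat n) → (K j ⊗ M) j ≗ r j · M
  K⊗-self j M = ·-congˡ M (K-row-self j)

  r-diag : (j : Fin n) → r j j ≡ -1ℤ
  r-diag j = cong -_ (sgn-double (toℕ j))

  K-involutive : (j : Fin n) → K j ⊗ K j ≋ Id
  K-involutive j = ≋-byRow j (λ i i≢j k → trans (K⊗-other (K j) i≢j k) (K-row-other i≢j k)) λ k → begin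
    (K j ⊗ K j) j k                  ≡⟨ K⊗-self j (K j) k ⟩
    (r j · K j) k                    ≡⟨ ·-K (r j) j k ⟩
    r j k + r j j * (r j k - e j k)  ≡⟨ cong (λ x → r j k + x * (r j k - e j k)) (r-diag j) ⟩
    r j k + -1ℤ * (r j k - e j k)    ≡⟨ cancel (r j k) (e j k) ⟩
    e j k                            ≡⟨ Id-sym k j ⟩
    Id j k                           ∎
    where
    open ≡-Reasoning
    cancel : ∀ a b → a + -1ℤ * (a + - b) ≡ b
    cancel = solve-∀

module _ {n : ℕ} (j : Fin n) where

  r-suc : (k : Fin (suc n)) → r (fsuc j) k ≡ - r (inject₁ j) k
  r-suc k = cong (λ t → - sgn (suc (t ℕ.+ toℕ k))) (sym (FinP.toℕ-inject₁ j))

  r-suc-inject₁ : r (fsuc j) (inject₁ j) ≡ 1ℤ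
  r-suc-inject₁ = begin
    - - sgn (toℕ j ℕ.+ toℕ (inject₁ j))  ≡⟨ ℤP.neg-involutive _ ⟩
    sgn (toℕ j ℕ.+ toℕ (inject₁ j))      ≡⟨ cong (λ t → sgn (toℕ j ℕ.+ t)) (FinP.toℕ-inject₁ j) ⟩
    sgn (toℕ j ℕ.+ toℕ j)                ≡⟨ sgn-double (toℕ j) ⟩
    1ℤ                                   ∎
    where open ≡-Reasoning

  r-suc·K : r (fsuc j) · K (inject₁ j) ≗ (λ k → - Id (inject₁ j) k)
  r-suc·K k = begin
    (r (fsuc j) · K (inject₁ j)) k
      ≡⟨ ·-K (r (fsuc j)) (inject₁ j) k ⟩
    r (fsuc j) k + r (fsuc j) (inject₁ j) * (r (inject₁ j) k - e (inject₁ j) k)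
      ≡⟨ cong₂ (λ x y → x + y * (r (inject₁ j) k - e (inject₁ j) k)) (r-suc k) r-suc-inject₁ ⟩
    - r (inject₁ j) k + 1ℤ * (r (inject₁ j) k - e (inject₁ j) k)
      ≡⟨ cancel (r (inject₁ j) k) (e (inject₁ j) k) ⟩
    - e (inject₁ j) k
      ≡⟨ cong -_ (Id-sym k (inject₁ j)) ⟩
    - Id (inject₁ j) k
      ∎
    where
    open ≡-Reasoning
    cancel : ∀ a b → - a + 1ℤ * (a + - b) ≡ - b
    cancel = solve-∀

descRows : ∀ {n} → Mat n
descRows fzero    k = r fzero k
descRows (fsuc i) k = - Id (inject₁ i) k

-- The partial product K (t ∸ 1) ⊗ ⋯ ⊗ K 0, by stair-step.
stair : ∀ {n} → ℕ → Mat n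
stair t i with toℕ i ℕP.<? t
... | yes _ = descRows i
... | no _  = Id i

module _ {n : ℕ} where

  stair-below : ∀ {t} (i : Fin n) → toℕ i < t → stair t i ≡ descRows i
  stair-below {t} i i<t with toℕ i ℕP.<? t
  ... | yes _   = refl
  ... | no i≮t = contradiction i<t i≮t

  stair-above : ∀ {t} (i : Fin n) → t ≤ toℕ i → stair t i ≡ Id i
  stair-above {t} i t≤i with toℕ i ℕP.<? t
  ... | yes i<t = contradiction i<t (ℕP.≤⇒≯ t≤i)
  ... | no _    = refl

  stair-suc-other : ∀ {t} (i : Fin n) → toℕ i ≢ t → stair t i ≡ stair (suc t) i
  stair-suc-other {t} i i≢t with toℕ i ℕP.<? t
  ... | yes i<t = sym (stair-below i (ℕP.m<n⇒m<1+n i<t))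
  ... | no i≮t  = sym (stair-above i (ℕP.≤∧≢⇒< (ℕP.≮⇒≥ i≮t) (i≢t ∘ sym)))

  stair-zero : stair 0 ≋ Id
  stair-zero i k = cong-app (stair-above i z≤n) k

  stair-full : stair n ≋ descRows
  stair-full i k = cong-app (stair-below i (FinP.toℕ<n i)) k

stair-step : ∀ {n} t (j : Fin n) → toℕ j ≡ t → K j ⊗ stair t ≋ stair (suc t)
r·stair    : ∀ {n} t (j : Fin n) → toℕ j ≡ t → r j · stair t ≗ descRows j

stair-step t j j≡t = ≋-byRow j
  (λ i i≢j k → trans (K⊗-other (stair t) i≢j k)
                     (cong-app (stair-suc-other i (λ i≡t → i≢j (FinP.toℕ-injective (trans i≡t (sym j≡t))))) k))
  (λ k → trans (K⊗-self j (stair t) k)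
               (trans (r·stair t j j≡t k) (sym (cong-app (stair-below j (s≤s (ℕP.≤-reflexive j≡t))) k))))

r·stair zero    fzero    refl k = trans (·-congʳ (r fzero) stair-zero k) (·-Id (r fzero) k)
r·stair (suc t) (fsuc j) j≡t  k = begin
  (r (fsuc j) · stair (suc t)) k                   ≡⟨ ·-congʳ (r (fsuc j)) (stair-step t (inject₁ j) j₋≡t) k ⟨
  (r (fsuc j) · (K (inject₁ j) ⊗ stair t)) k       ≡⟨ ·-assoc (r (fsuc j)) (K (inject₁ j)) (stair t) k ⟩
  ((r (fsuc j) · K (inject₁ j)) · stair t) k       ≡⟨ ·-congˡ (stair t) (r-suc·K j) k ⟩
  ((λ l → - Id (inject₁ j) l) · stair t) k         ≡⟨ neg-· (Id (inject₁ j)) (stair t) k ⟩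
  - (Id (inject₁ j) · stair t) k                   ≡⟨ cong -_ (Id-· (inject₁ j) (stair t) k) ⟩
  - stair t (inject₁ j) k                          ≡⟨ cong (λ row → - row k) (stair-above (inject₁ j) j₋≥t) ⟩
  - Id (inject₁ j) k                               ∎
  where
  open ≡-Reasoning
  j₋≡t : toℕ (inject₁ j) ≡ t
  j₋≡t = trans (FinP.toℕ-inject₁ j) (ℕP.suc-injective j≡t)
  j₋≥t : t ≤ toℕ (inject₁ j)
  j₋≥t = ℕP.≤-reflexive (sym j₋≡t)

stair-foldl : ∀ {n} t s (h : Fin t → Fin n) {M : Mat n} → (∀ i → toℕ (h i) ≡ s ℕ.+ toℕ i) →
              M ≋ stair s → foldl (λ A j → K j ⊗ A) M (tabulate h) ≋ stair (s ℕ.+ t)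
stair-foldl zero    s h h-consecutive M≋stair rewrite ℕP.+-identityʳ s = M≋stair
stair-foldl (suc t) s h h-consecutive M≋stair rewrite ℕP.+-suc s t =
  stair-foldl t (suc s) (h ∘ fsuc) (λ i → trans (h-consecutive (fsuc i)) (ℕP.+-suc s (toℕ i)))
    (≋-trans (⊗-congˡ (K (h fzero)) M≋stair)
             (stair-step s (h fzero) (trans (h-consecutive fzero) (ℕP.+-identityʳ s))))

prodDesc≋descRows : ∀ n → prodDesc n ≋ descRows
prodDesc≋descRows n = begin
  foldr _⊗_ Id (reverse (map K (allFin n)))  ≡⟨ ListP.reverse-foldr _⊗_ Id (map K (allFin n)) ⟩
  foldl (λ A B → B ⊗ A) Id (map K (allFin n))  ≡⟨ ListP.foldl-map (λ A B → B ⊗ A) K Id (allFin n) ⟩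
  foldl (λ A j → K j ⊗ A) Id (allFin n)        ≈⟨ stair-foldl n 0 id (λ _ → refl) (≋-sym stair-zero) ⟩
  stair n                                      ≈⟨ stair-full ⟩
  descRows                                     ∎
  where open ≋-Reasoning

prodAsc⊗prodDesc≋Id : ∀ n → prodAsc n ⊗ prodDesc n ≋ Id
prodAsc⊗prodDesc≋Id n = prodL-reverse-inverse K K-involutive (allFin n)

module _ (m : ℕ) where

  descFormula : Mat (suc m)
  descFormula = outer (e fzero) (r fzero) ⊕ (⊝ ΣM m (λ j → outer (e (fsuc j)) (e (inject₁ j))))

  ascFormula : Mat (suc m)
  ascFormula = (⊝ ΣM m (λ j → outer (e (inject₁ j)) (e (fsuc j)))) ⊕ outer (e (fromℕ m)) (r (fromℕ m))

  descFormula≋descRows : descFormula ≋ descRows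
  descFormula≋descRows fzero k = begin
    1ℤ * r fzero k + - Σ {m} (λ _ → 0ℤ)  ≡⟨ cong (λ s → 1ℤ * r fzero k + - s) (Σ-zero {m}) ⟩
    1ℤ * r fzero k + 0ℤ                 ≡⟨ ℤP.+-identityʳ _ ⟩
    1ℤ * r fzero k                      ≡⟨ ℤP.*-identityˡ _ ⟩
    r fzero k                           ∎
    where open ≡-Reasoning
  descFormula≋descRows (fsuc i) k = begin
    0ℤ + - Σ (λ j → Id (fsuc i) (fsuc j) * e (inject₁ j) k)  ≡⟨ ℤP.+-identityˡ _ ⟩
    - Σ (λ j → Id (fsuc i) (fsuc j) * e (inject₁ j) k)       ≡⟨ cong -_ (Σ-cong (λ j → cong (_* e (inject₁ j) k) (Id-suc i j))) ⟩
    - Σ (λ j → Id i j * e (inject₁ j) k)                     ≡⟨ cong -_ (Σ-Id* i (λ j → e (inject₁ j) k)) ⟩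
    - Id k (inject₁ i)                                       ≡⟨ cong -_ (Id-sym k (inject₁ i)) ⟩
    - Id (inject₁ i) k                                       ∎
    where open ≡-Reasoning

  ascFormula-inject₁ : (i : Fin m) → ascFormula (inject₁ i) ≗ (λ k → - Id (fsuc i) k)
  ascFormula-inject₁ i k = begin
    - Σ (λ j → Id (inject₁ i) (inject₁ j) * e (fsuc j) k) + Id (inject₁ i) (fromℕ m) * r (fromℕ m) k
      ≡⟨ cong₂ (λ s x → - s + x * r (fromℕ m) k)
               (Σ-cong (λ j → cong (_* e (fsuc j) k) (Id-inject₁ i j)))
               (Id-off {i = inject₁ i} (FinP.fromℕ≢inject₁ ∘ sym)) ⟩
    - Σ (λ j → Id i j * e (fsuc j) k) + 0ℤ
      ≡⟨ ℤP.+-identityʳ _ ⟩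
    - Σ (λ j → Id i j * e (fsuc j) k)
      ≡⟨ cong -_ (trans (Σ-Id* i (λ j → e (fsuc j) k)) (Id-sym k (fsuc i))) ⟩
    - Id (fsuc i) k
      ∎
    where open ≡-Reasoning

  ascFormula-last : ascFormula (fromℕ m) ≗ r (fromℕ m)
  ascFormula-last k = begin
    - Σ (λ j → Id (fromℕ m) (inject₁ j) * e (fsuc j) k) + Id (fromℕ m) (fromℕ m) * r (fromℕ m) k
      ≡⟨ cong₂ (λ s x → - s + x * r (fromℕ m) k)
               (trans (Σ-cong (λ j → cong (_* e (fsuc j) k) (Id-off (FinP.fromℕ≢inject₁ {i = j})))) (Σ-zero {m}))
               (Id-diag (fromℕ m)) ⟩
    0ℤ + 1ℤ * r (fromℕ m) k
      ≡⟨ trans (ℤP.+-identityˡ _) (ℤP.*-identityˡ _) ⟩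
    r (fromℕ m) k
      ∎
    where open ≡-Reasoning

  r-fzero-fromℕ*r-fromℕ : (k : Fin (suc m)) → r fzero (fromℕ m) * r (fromℕ m) k ≡ sgn (toℕ k)
  r-fzero-fromℕ*r-fromℕ k rewrite FinP.toℕ-fromℕ m = begin
    - sgn m * - sgn (m ℕ.+ toℕ k)         ≡⟨ cong (λ s → - sgn m * - s) (sgn-+ m (toℕ k)) ⟩
    - sgn m * - (sgn m * sgn (toℕ k))     ≡⟨ neg*neg (sgn m) (sgn (toℕ k)) ⟩
    sgn m * sgn m * sgn (toℕ k)           ≡⟨ cong (_* sgn (toℕ k)) (sgn-square m) ⟩
    1ℤ * sgn (toℕ k)                      ≡⟨ ℤP.*-identityˡ _ ⟩
    sgn (toℕ k)                           ∎
    where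
    open ≡-Reasoning
    neg*neg : ∀ x y → - x * - (x * y) ≡ x * x * y
    neg*neg = solve-∀

  descRows⊗ascFormula : descRows ⊗ ascFormula ≋ Id
  descRows⊗ascFormula fzero k = begin
    (r fzero · ascFormula) k
      ≡⟨ Σ-init-last (λ l → r fzero l * ascFormula l k) ⟩
    Σ (λ l → r fzero (inject₁ l) * ascFormula (inject₁ l) k) + r fzero (fromℕ m) * ascFormula (fromℕ m) k
      ≡⟨ cong₂ _+_ (Σ-cong (λ l → cong (r fzero (inject₁ l) *_) (ascFormula-inject₁ l k)))
                   (trans (cong (r fzero (fromℕ m) *_) (ascFormula-last k)) (r-fzero-fromℕ*r-fromℕ k)) ⟩
    Σ (λ l → r fzero (inject₁ l) * - Id (fsuc l) k) + sgn (toℕ k)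
      ≡⟨ row₀ k ⟩
    Id fzero k
      ∎
    where
    open ≡-Reasoning
    row₀ : (k : Fin (suc m)) → Σ (λ l → r fzero (inject₁ l) * - Id (fsuc l) k) + sgn (toℕ k) ≡ Id fzero k
    row₀ fzero = cong (_+ 1ℤ) (trans (Σ-*ʳ 0ℤ (r fzero ∘ inject₁ {m})) (ℤP.*-zeroʳ (Σ (r fzero ∘ inject₁ {m}))))
    row₀ (fsuc k) = begin
      Σ (λ l → r fzero (inject₁ l) * - Id (fsuc l) (fsuc k)) + sgn (suc (toℕ k))
        ≡⟨ cong (_+ sgn (suc (toℕ k))) (Σ-cong (λ l → trans (cong (λ x → r fzero (inject₁ l) * - x) (Id-suc l k))
                                                             (sym (ℤP.neg-distribʳ-* (r fzero (inject₁ l)) (Id l k))))) ⟩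
      Σ (λ l → - (r fzero (inject₁ l) * Id l k)) + sgn (suc (toℕ k))
        ≡⟨ cong (_+ sgn (suc (toℕ k)))
                (trans (Σ-neg (λ l → r fzero (inject₁ l) * Id l k)) (cong -_ (Σ-*Id (r fzero ∘ inject₁) k))) ⟩
      - r fzero (inject₁ k) + sgn (suc (toℕ k))
        ≡⟨ cong (λ t → - sgn (suc t) + sgn (suc (toℕ k))) (FinP.toℕ-inject₁ k) ⟩
      - sgn (suc (toℕ k)) + sgn (suc (toℕ k))
        ≡⟨ ℤP.+-inverseˡ (sgn (suc (toℕ k))) ⟩
      0ℤ
        ∎
  descRows⊗ascFormula (fsuc i) k = begin
    ((λ l → - Id (inject₁ i) l) · ascFormula) k  ≡⟨ neg-· (Id (inject₁ i)) ascFormula k ⟩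
    - (Id (inject₁ i) · ascFormula) k            ≡⟨ cong -_ (Id-· (inject₁ i) ascFormula k) ⟩
    - ascFormula (inject₁ i) k                   ≡⟨ cong -_ (ascFormula-inject₁ i k) ⟩
    - - Id (fsuc i) k                            ≡⟨ ℤP.neg-involutive _ ⟩
    Id (fsuc i) k                                ∎
    where open ≡-Reasoning

  prodAsc≋ascFormula : prodAsc (suc m) ≋ ascFormula
  prodAsc≋ascFormula = inverseˡ≋inverseʳ (prodAsc⊗prodDesc≋Id (suc m))
    (≋-trans (⊗-congʳ ascFormula (prodDesc≋descRows (suc m))) descRows⊗ascFormula)

cyclicPred : ∀ {n} → Fin (suc n) → Fin (suc n)
cyclicPred fzero    = fromℕ _
cyclicPred (fsuc i) = inject₁ i

cyclicPred^ : ∀ {n} → ℕ → Fin (suc n) → Fin (suc n)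
cyclicPred^ zero    c = c
cyclicPred^ (suc p) c = cyclicPred^ p (cyclicPred c)

module _ {n : ℕ} where

  toℕ-cyclicPred^ : ∀ p s (c : Fin (suc n)) → toℕ c ≡ p ℕ.+ s → toℕ (cyclicPred^ p c) ≡ s
  toℕ-cyclicPred^ zero    s c        c≡s   = c≡s
  toℕ-cyclicPred^ (suc p) s (fsuc c) c≡p+s =
    toℕ-cyclicPred^ p s (inject₁ c) (trans (FinP.toℕ-inject₁ c) (ℕP.suc-injective c≡p+s))

  cyclicPred^-+ : ∀ a b (c : Fin (suc n)) → cyclicPred^ (a ℕ.+ b) c ≡ cyclicPred^ b (cyclicPred^ a c)
  cyclicPred^-+ zero    b c = refl
  cyclicPred^-+ (suc a) b c = cyclicPred^-+ a b (cyclicPred c)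

  cyclicPred^-full : (c : Fin (suc n)) → cyclicPred^ (suc n) c ≡ c
  cyclicPred^-full c = begin
    cyclicPred^ (suc n) c                                  ≡⟨ cong (λ p → cyclicPred^ p c) split ⟩
    cyclicPred^ (toℕ c ℕ.+ suc (n ∸ toℕ c)) c              ≡⟨ cyclicPred^-+ (toℕ c) (suc (n ∸ toℕ c)) c ⟩
    cyclicPred^ (suc (n ∸ toℕ c)) (cyclicPred^ (toℕ c) c)  ≡⟨ cong (cyclicPred^ (suc (n ∸ toℕ c))) reach-zero ⟩
    cyclicPred^ (n ∸ toℕ c) (fromℕ n)                      ≡⟨ FinP.toℕ-injective back ⟩
    c                                                      ∎
    where
    open ≡-Reasoning
    c≤n : toℕ c ≤ n
    c≤n = ℕ.s≤s⁻¹ (FinP.toℕ<n c)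
    split : suc n ≡ toℕ c ℕ.+ suc (n ∸ toℕ c)
    split = sym (trans (ℕP.+-suc (toℕ c) (n ∸ toℕ c)) (cong suc (ℕP.m+[n∸m]≡n c≤n)))
    reach-zero : cyclicPred^ (toℕ c) c ≡ fzero
    reach-zero = FinP.toℕ-injective (toℕ-cyclicPred^ (toℕ c) 0 c (sym (ℕP.+-identityʳ (toℕ c))))
    back : toℕ (cyclicPred^ (n ∸ toℕ c) (fromℕ n)) ≡ toℕ c
    back = toℕ-cyclicPred^ (n ∸ toℕ c) (toℕ c) (fromℕ n) (trans (FinP.toℕ-fromℕ n) (sym (ℕP.m∸n+n≡m c≤n)))

  cyclicPred^-zero≢zero : ∀ {N} → 1 ≤ N → N ≤ n → cyclicPred^ N (fzero {n}) ≢ fzero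
  cyclicPred^-zero≢zero {suc N} _ N<n returns = ℕP.m<n⇒n≢0 (ℕP.m<n⇒0<n∸m N<n) (begin
    n ∸ N                                ≡⟨ toℕ-cyclicPred^ N (n ∸ N) (fromℕ n) fromℕ-split ⟨
    toℕ (cyclicPred^ N (fromℕ n))        ≡⟨ cong toℕ returns ⟩
    0                                    ∎)
    where
    open ≡-Reasoning
    fromℕ-split : toℕ (fromℕ n) ≡ N ℕ.+ (n ∸ N)
    fromℕ-split = trans (FinP.toℕ-fromℕ n) (sym (ℕP.m+[n∸m]≡n (ℕP.<⇒≤ N<n)))

  -- The row ê c of the proof idea: e c for c < n, and -(1, …, 1) for c = n.
  cyclicRow : Fin (suc n) → Vecℤ n
  cyclicRow c k = Id c (inject₁ k) - Id c (fromℕ n)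

  cyclicRow-inject₁ : (i k : Fin n) → cyclicRow (inject₁ i) k ≡ Id i k
  cyclicRow-inject₁ i k =
    trans (cong₂ _-_ (Id-inject₁ i k) (Id-off {i = inject₁ i} (FinP.fromℕ≢inject₁ ∘ sym))) (ℤP.+-identityʳ (Id i k))

  Σ-cyclicRow : (k : Fin n) → Σ (λ c → cyclicRow c k) ≡ 0ℤ
  Σ-cyclicRow k = begin
    Σ (λ c → Id c (inject₁ k) - Id c (fromℕ n))
      ≡⟨ Σ-+ (λ c → Id c (inject₁ k)) (λ c → - Id c (fromℕ n)) ⟩
    Σ (λ c → Id c (inject₁ k)) + Σ (λ c → - Id c (fromℕ n))
      ≡⟨ cong₂ _+_ (Σ-Id (inject₁ k)) (trans (Σ-neg (λ c → Id c (fromℕ n))) (cong -_ (Σ-Id (fromℕ n)))) ⟩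
    1ℤ - 1ℤ
      ∎
    where open ≡-Reasoning

  Σ-∘cyclicPred : (f : Fin (suc n) → ℤ) → Σ (f ∘ cyclicPred) ≡ Σ f
  Σ-∘cyclicPred f = begin
    Σ (f ∘ cyclicPred)                  ≡⟨ Σ-suc (f ∘ cyclicPred) ⟩
    f (fromℕ n) + Σ (f ∘ inject₁)       ≡⟨ ℤP.+-comm (f (fromℕ n)) (Σ (f ∘ inject₁)) ⟩
    Σ (f ∘ inject₁) + f (fromℕ n)       ≡⟨ Σ-init-last f ⟨
    Σ f                                 ∎
    where open ≡-Reasoning

  Σ-∘cyclicPred^ : ∀ p (f : Fin (suc n) → ℤ) → Σ (f ∘ cyclicPred^ p) ≡ Σ f
  Σ-∘cyclicPred^ zero    f = refl
  Σ-∘cyclicPred^ (suc p) f = trans (Σ-∘cyclicPred (f ∘ cyclicPred^ p)) (Σ-∘cyclicPred^ p f)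

  Σ-cyclicRow-init : ∀ p (k : Fin n) →
    Σ (λ l → cyclicRow (cyclicPred^ p (inject₁ l)) k) ≡ - cyclicRow (cyclicPred^ p (fromℕ n)) k
  Σ-cyclicRow-init p k = ℤ+.inverseˡ-unique _ _ (begin
    Σ (g ∘ inject₁) + g (fromℕ n)     ≡⟨ Σ-init-last g ⟨
    Σ g                              ≡⟨ Σ-∘cyclicPred^ p (λ c → cyclicRow c k) ⟩
    Σ (λ c → cyclicRow c k)          ≡⟨ Σ-cyclicRow k ⟩
    0ℤ                               ∎)
    where
    open ≡-Reasoning
    g : Fin (suc n) → ℤ
    g c = cyclicRow (cyclicPred^ p c) k

  descPower : ℕ → Mat n
  descPower p i k = sgn (toℕ i ℕ.+ toℕ k) * cyclicRow (cyclicPred^ p (inject₁ i)) k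

  sgn*Id : (i k : Fin n) → sgn (toℕ i ℕ.+ toℕ k) * Id i k ≡ Id i k
  sgn*Id i k with i ≟ k
  ... | yes refl = cong (_* 1ℤ) (sgn-double (toℕ i))
  ... | no _     = ℤP.*-zeroʳ (sgn (toℕ i ℕ.+ toℕ k))

  descPower-zero : descPower 0 ≋ Id
  descPower-zero i k = trans (cong (sgn (toℕ i ℕ.+ toℕ k) *_) (cyclicRow-inject₁ i k)) (sgn*Id i k)

  descPower-period : descPower (suc n) ≋ descPower 0
  descPower-period i k = cong (λ c → sgn (toℕ i ℕ.+ toℕ k) * cyclicRow c k) (cyclicPred^-full (inject₁ i))

descRows⊗descPower : ∀ {n} p → descRows ⊗ descPower {n} p ≋ descPower (suc p)
descRows⊗descPower {suc n} p fzero k = begin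
  Σ (λ l → sgn (suc (toℕ l)) * (sgn (toℕ l ℕ.+ toℕ k) * X (inject₁ l)))
    ≡⟨ Σ-cong (λ l → trans (sym (ℤP.*-assoc (sgn (suc (toℕ l))) (sgn (toℕ l ℕ.+ toℕ k)) (X (inject₁ l))))
                           (cong (_* X (inject₁ l)) (sgn-suc-cancel (toℕ l) (toℕ k)))) ⟩
  Σ (λ l → - sgn (toℕ k) * X (inject₁ l))
    ≡⟨ Σ-*ˡ (- sgn (toℕ k)) (X ∘ inject₁) ⟩
  - sgn (toℕ k) * Σ (X ∘ inject₁)
    ≡⟨ cong (- sgn (toℕ k) *_) (Σ-cyclicRow-init p k) ⟩
  - sgn (toℕ k) * - X (fromℕ (suc n))
    ≡⟨ neg*neg (sgn (toℕ k)) (X (fromℕ (suc n))) ⟩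
  sgn (toℕ k) * X (fromℕ (suc n))
    ∎
  where
  open ≡-Reasoning
  X : Fin (suc (suc n)) → ℤ
  X c = cyclicRow (cyclicPred^ p c) k
  neg*neg : ∀ x y → - x * - y ≡ x * y
  neg*neg = solve-∀
descRows⊗descPower {suc n} p (fsuc i) k = begin
  ((λ l → - Id (inject₁ i) l) · descPower p) k                   ≡⟨ neg-· (Id (inject₁ i)) (descPower p) k ⟩
  - (Id (inject₁ i) · descPower p) k                             ≡⟨ cong -_ (Id-· (inject₁ i) (descPower p) k) ⟩
  - (sgn (toℕ (inject₁ i) ℕ.+ toℕ k) * X)                      ≡⟨ cong (λ t → - (sgn (t ℕ.+ toℕ k) * X)) (FinP.toℕ-inject₁ i) ⟩
  - (sgn (toℕ i ℕ.+ toℕ k) * X)                                ≡⟨ ℤP.neg-distribˡ-* (sgn (toℕ i ℕ.+ toℕ k)) X ⟩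
  - sgn (toℕ i ℕ.+ toℕ k) * X                                  ∎
  where
  open ≡-Reasoning
  X : ℤ
  X = cyclicRow (cyclicPred^ p (inject₁ (inject₁ i))) k

descRows^≋descPower : ∀ {n} p → descRows ^ p ≋ descPower {n} p
descRows^≋descPower zero    = ≋-sym descPower-zero
descRows^≋descPower (suc p) = ≋-trans (⊗-congˡ descRows (descRows^≋descPower p)) (descRows⊗descPower p)

-Id≢1 : ∀ {n} (a b : Fin n) → - Id a b ≢ 1ℤ
-Id≢1 a b with a ≟ b
... | yes _ = λ ()
... | no _  = λ ()

descPower-corner≢1 : ∀ {n N} → 1 ≤ N → N ≤ suc n → descPower {suc n} N fzero fzero ≢ 1ℤ
descPower-corner≢1 {n} {N} 1≤N N≤n corner≡1 = -Id≢1 c (fromℕ (suc n)) (begin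
  - Id c (fromℕ (suc n))                   ≡⟨ ℤP.+-identityˡ _ ⟨
  0ℤ - Id c (fromℕ (suc n))                ≡⟨ cong (_- Id c (fromℕ (suc n))) (Id-off {i = c} {k = fzero} c≢0) ⟨
  Id c fzero - Id c (fromℕ (suc n))        ≡⟨ ℤP.*-identityˡ _ ⟨
  1ℤ * (Id c fzero - Id c (fromℕ (suc n))) ≡⟨ corner≡1 ⟩
  1ℤ                                       ∎)
  where
  open ≡-Reasoning
  c : Fin (suc (suc n))
  c = cyclicPred^ N fzero
  c≢0 : c ≢ fzero
  c≢0 = cyclicPred^-zero≢zero 1≤N N≤n

theorem2p7 : (m : ℕ) →
    (prodDesc (suc m) ≋ outer (e fzero) (r fzero) ⊕ (⊝ ΣM m (λ j → outer (e (fsuc j)) (e (inject₁ j)))))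
    × (prodAsc (suc m) ≋ (⊝ ΣM m (λ j → outer (e (inject₁ j)) (e (fsuc j)))) ⊕ outer (e (fromℕ m)) (r (fromℕ m)))
    × (prodDesc (suc m) ^ suc (suc m) ≋ Id)
    × (prodAsc (suc m) ^ suc (suc m) ≋ Id)
    × (∀ (N : ℕ) → 1 ≤ N → N < suc (suc m) →
         ¬ ((prodDesc (suc m) ^ N ≋ Id) × (prodAsc (suc m) ^ N ≋ Id)))
theorem2p7 m = desc-closed , prodAsc≋ascFormula m , desc-order , asc-order , minimal
  where
  D^≋descPower : ∀ p → prodDesc (suc m) ^ p ≋ descPower p
  D^≋descPower p = ≋-trans (^-cong (prodDesc≋descRows (suc m)) p) (descRows^≋descPower p)

  desc-closed : prodDesc (suc m) ≋ descFormula m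
  desc-closed = ≋-trans (prodDesc≋descRows (suc m)) (≋-sym (descFormula≋descRows m))

  desc-order : prodDesc (suc m) ^ suc (suc m) ≋ Id
  desc-order = ≋-trans (D^≋descPower (suc (suc m))) (≋-trans descPower-period descPower-zero)

  asc-order : prodAsc (suc m) ^ suc (suc m) ≋ Id
  asc-order = inverse-^≋Id {A = prodAsc (suc m)} (prodAsc⊗prodDesc≋Id (suc m)) (suc (suc m)) desc-order

  minimal : ∀ N → 1 ≤ N → N < suc (suc m) → ¬ ((prodDesc (suc m) ^ N ≋ Id) × (prodAsc (suc m) ^ N ≋ Id))
  minimal N 1≤N N<2+m (D^N≋Id , _) =
    descPower-corner≢1 1≤N (ℕ.s≤s⁻¹ N<2+m) (trans (sym (D^≋descPower N fzero fzero)) (D^N≋Id fzero fzero))
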